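{- Work in Second Order Arithmetic. Let $S$ be a real with $\mathrm{Set}(S)$, and let $\vec a \in S$. Then $\mathrm{Set}(\vec a^{S})$, where $\vec a^{S} = \{\vec b \mid \vec a \frown \vec b \in S\}$.
   Context: Fix a recursive coding of finite tuples of natural numbers by natural numbers (with recursive length and projection functions); a "real" is a set of natural numbers. For tuples $\vec a = \langle a_0,\dots,a_n\rangle$, $\vec b = \langle b_0,\dots,b_m\rangle$, write $\vec a \frown \vec b = \langle a_0,\dots,a_n,b_0,\dots,b_m\rangle$, and for a number $\hat a$, $\vec a \frown \hat a = \vec a \frown \langle \hat a\rangle$. For a real $X$ of tuples, $\vec a^{X} = \{\vec b \mid \vec a \frown \vec b \in X\}$. $\mathrm{Set}(S)$ means: $S$ is a non-empty real consisting only of (codes of) tuples, $S$ is a tree (closed under initial segments), and $S$ is well-founded in the sense that for every real $X$, if $X \subseteq S$ and $X$ is inductive relative to $S$, i.e. $\forall \vec a \in S\, [(\forall \hat a\, (\vec a \frown \hat a \in S \rightarrow \vec a \frown \hat a \in X)) \rightarrow \vec a \in X]$, then $X = S$. -}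

module Defs where

open import Data.Nat using (ℕ)
open import Data.List using (List; []; _∷_; _++_; [_])
open import Data.Product using (Σ; _×_)

-- Tuples of natural numbers are represented directly as lists (the
-- recursive coding is taken to be a bijection List ℕ ≅ ℕ, so that every
-- code is a tuple).
Tuple : Set
Tuple = List ℕ

Real : Set₁
Real = Tuple → Set

_⊆_ : Real → Real → Set
X ⊆ Y = ∀ a → X a → Y a

_^_ : Tuple → Real → Real
(a ^ X) b = X (a ++ b)

NonEmpty : Real → Set
NonEmpty S = Σ Tuple S

IsTree : Real → Set
IsTree S = ∀ a b → S (a ++ b) → S a

InductiveRel : Real → Real → Set
InductiveRel S X = ∀ a → S a → (∀ k → S (a ++ [ k ]) → X (a ++ [ k ])) → X a

WellFounded : Real → Set₁
WellFounded S = ∀ (X : Real) → X ⊆ S → InductiveRel S X → (X ⊆ S × S ⊆ X)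

IsSet : Real → Set₁
IsSet S = NonEmpty S × IsTree S × WellFounded S

-- For well-foundedness, an inductive X ⊆ a⃗^S is
-- lifted to the real of those c⃗ ∈ S all of whose decompositions c⃗ = a⃗ ⁀ b⃗
-- have b⃗ ∈ X; this lift is inductive relative to S, hence contains S, and
-- reading it at a⃗ ⁀ b⃗ gives a⃗^S ⊆ X.
module Submission where

open import Defs
open import Data.List using ([]; _++_; [_])
open import Data.List.Properties using (++-identityʳ; ++-assoc)
open import Data.Product using (_×_; _,_; proj₁; proj₂)
open import Relation.Binary.PropositionalEquality
  using (_≡_; refl; sym; trans; cong; subst)

^-nonEmpty : ∀ {S} a → S a → NonEmpty (a ^ S)
^-nonEmpty {S} a Sa = [] , subst S (sym (++-identityʳ a)) Sa

^-isTree : ∀ {S} a → IsTree S → IsTree (a ^ S)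
^-isTree {S} a tree b c Sabc = tree (a ++ b) c (subst S (sym (++-assoc a b c)) Sabc)

liftAbove : Tuple → Real → Real → Real
liftAbove a S X c = S c × (∀ b → c ≡ a ++ b → X b)

liftAbove-inductive : ∀ {S X} a → InductiveRel (a ^ S) X →
                      InductiveRel S (liftAbove a S X)
liftAbove-inductive {S} a ind c Sc step = Sc , λ b c≡ab →
  ind b (subst S c≡ab Sc) λ k Sabk →
    proj₂ (step k (subst S (sym (extend c≡ab k)) Sabk)) (b ++ [ k ]) (extend c≡ab k)
  where
  extend : ∀ {b} → c ≡ a ++ b → ∀ k → c ++ [ k ] ≡ a ++ (b ++ [ k ])
  extend {b} c≡ab k = trans (cong (_++ [ k ]) c≡ab) (++-assoc a b [ k ])

^-wellFounded : ∀ {S} a → WellFounded S → WellFounded (a ^ S)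
^-wellFounded {S} a wf X X⊆aS ind = X⊆aS , aS⊆X
  where
  S⊆lift : S ⊆ liftAbove a S X
  S⊆lift = proj₂ (wf (liftAbove a S X) (λ _ → proj₁) (liftAbove-inductive a ind))

  aS⊆X : (a ^ S) ⊆ X
  aS⊆X b Sab = proj₂ (S⊆lift (a ++ b) Sab) b refl

mainTheorem2 : (S : Real) → IsSet S → (a : Tuple) → S a → IsSet (a ^ S)
mainTheorem2 S (_ , tree , wf) a Sa =
  ^-nonEmpty {S} a Sa , ^-isTree a tree , ^-wellFounded a wf
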